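{- Let $n/2<k_1,k_2<n$ and set $\ell=\min(n-k_1,n-k_2)$. Then the polynomial $H_{n,(k_1,k_2)}(x)$ has degree $\ell$ and its leading coefficient equals \[(n-2\ell)!\,\ell!\,\binom{n-k_1}{\ell}\binom{n-k_2}{\ell}.\]
   Context: $S_n$ is the set of permutations of $\{1,\dots,n\}$. A $(k_1,k_2)$-step inversion of $\pi\in S_n$ is a pair $(a,b)$ with $1\le a<b\le n$, $b-a=k_1$ and $\pi(a)-\pi(b)=k_2$; $\operatorname{inv}_{(k_1,k_2)}(\pi)$ is the number of these. $H_{n,(k_1,k_2)}(x)=\sum_{\pi\in S_n}x^{\operatorname{inv}_{(k_1,k_2)}(\pi)}$. -}

module Defs where

open import Data.Nat using (ℕ; zero; suc; _+_; _*_; _∸_; _≟_)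
open import Data.Nat.Base using (_!)
open import Data.Bool using (Bool; true; false; _∧_)
open import Data.List using (List; []; _∷_; length; map; concatMap; upTo; filterᵇ; insertAt; allFin)
open import Data.Fin using (Fin)
open import Relation.Nullary.Decidable using (⌊_⌋)

-- A permutation π ∈ S_n is encoded as the list [π(1)-1, …, π(n)-1],
-- i.e. a list that is an arrangement of 0,1,…,n-1 (0-indexed shift of
-- positions and values; all differences are unchanged).

insertions : ℕ → List ℕ → List (List ℕ)
insertions x xs = map (λ i → insertAt xs i x) (allFin (suc (length xs)))

perms : ℕ → List (List ℕ)
perms zero    = [] ∷ []
perms (suc n) = concatMap (insertions n) (perms n)

-- 0-indexed lookup with default (never used out of range below)
at : List ℕ → ℕ → ℕ
at []       _       = 0
at (x ∷ xs) zero    = x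
at (x ∷ xs) (suc i) = at xs i

-- inv_{(k1,k2)}(π): number of pairs (a,b), a<b, b-a = k1, π(a)-π(b) = k2.
-- With 0-indexed positions a ∈ {0,…,n-1-k1}, b = a + k1, and the
-- condition π(a) = π(b) + k2 (integer equation, stated in ℕ).
invStep : ℕ → ℕ → List ℕ → ℕ
invStep k₁ k₂ π =
  length (filterᵇ (λ a → ⌊ at π a ≟ at π (a + k₁) + k₂ ⌋)
                  (upTo (length π ∸ k₁)))

-- coefficient of x^j in H_{n,(k1,k2)}(x) = Σ_{π∈S_n} x^{inv(π)}
Hcoeff : ℕ → ℕ → ℕ → ℕ → ℕ
Hcoeff n k₁ k₂ j = length (filterᵇ (λ π → ⌊ invStep k₁ k₂ π ≟ j ⌋) (perms n))

module Submission where

-- Put m₁ = n − k₁ and m₂ = n − k₂. A (k₁,k₂)-inversion (a, a + k₁) of π with π(a + k₁) = v forces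
-- a < m₁ and v < m₂, and distinct inversions have distinct v. So the inversions of π form a partial
-- matching between {0,…,m₁−1} and {0,…,m₂−1}, of size at most ℓ = min(m₁, m₂). Since k₁ > m₁ and
-- k₂ > m₂, a matching of size ℓ prescribes π at 2ℓ distinct positions with 2ℓ distinct values, which
-- leaves (n − 2ℓ)! permutations, and there are ℓ! C(m₁, ℓ) C(m₂, ℓ) such matchings.

open import Relation.Binary.PropositionalEquality
import Algebra.Properties.CommutativeSemigroup as CommSemigroupProperties
open import Data.Bool using (Bool; true; false; _∧_; _∨_; not)
open import Data.Empty using (⊥; ⊥-elim)
open import Data.Fin using (Fin; toℕ) renaming (zero to fzero; suc to fsuc)
open import Data.Fin.Properties using (toℕ<n)
open import Data.List using (List; []; _∷_; _++_; length; map; concatMap; upTo; filterᵇ; insertAt; allFin; tabulate; zip)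
open import Data.List.Membership.Propositional using (_∈_)
open import Data.List.Properties using (length-upTo; length-map; length-zipWith; map-∘; map-++; map-applyUpTo; map-upTo)
open import Data.List.Relation.Binary.Permutation.Propositional
  using (_↭_; ↭⇒↭ₛ; ↭-refl; ↭-trans) renaming (prep to ↭-prep; swap to ↭-swap)
open import Data.List.Relation.Binary.Permutation.Propositional.Properties
  using (All-resp-↭; ↭-length) renaming (map⁺ to ↭-map⁺)
open import Data.List.Relation.Unary.All as All using (All; []; _∷_)
open import Data.List.Relation.Unary.All.Properties using (all-upTo; concat⁺; map⁺; tabulate⁺)
open import Data.List.Relation.Unary.Any using (here; there)
open import Data.List.Relation.Unary.Unique.Propositional using (Unique; []; _∷_)
open import Data.List.Relation.Unary.Unique.Propositional.Properties using (upTo⁺)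
open import Data.Nat using (ℕ; zero; suc; _+_; _*_; _∸_; _<_; _≤_; _⊓_; z≤n; s≤s; _≟_; _<?_; _≤?_; _≤ᵇ_)
open import Data.Nat.Base using (_!; ≢-nonZero⁻¹)
open import Data.Nat.Combinatorics using (_C_; nCk≡nPk/k!; nCn≡1)
open import Data.Nat.Combinatorics.Base using (_P′_)
import Data.Nat.Combinatorics.Base as Combinatorics
open import Data.Nat.Combinatorics.Specification using (k!∣nP′k)
open import Data.Nat.Divisibility using (_∣_; 0∣⇒≡0; ∣-trans; *-monoʳ-∣; m∣m*n; n∣m*n)
open import Data.Nat.DivMod using (_/_; m*[n/m]≡n)
open import Data.Nat.ListAction using (sum; product)
open import Data.Nat.ListAction.Properties using (sum-++; product-++; product-↭)
open import Data.Nat.Properties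
open import Data.Nat.Solver using (module +-*-Solver)
open import Data.Product using (_×_; _,_; proj₁; proj₂; ∃; ∃₂; uncurry; map₁; swap)
open import Data.Sum using (_⊎_; inj₁; inj₂)
open import Function using (id)
open import Function.Bundles using (mk⇔)
open import Relation.Nullary using (Dec; yes; no)
open import Relation.Nullary.Decidable using (⌊_⌋; isYes≗does; dec-true; dec-false; does-⇔)

open import Defs
open import Data.List.Relation.Binary.Permutation.Setoid.Properties (setoid ℕ) using (Unique-resp-↭)

open CommSemigroupProperties +-commutativeSemigroup using () renaming (interchange to +-interchange)
open CommSemigroupProperties *-commutativeSemigroup using () renaming (x∙yz≈y∙xz to *-left-comm)
open +-*-Solver using (solve; _:*_; _:=_; con)
open ≡-Reasoning

private
  variable
    A B : Set

infix 4 _==_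
_==_ : ℕ → ℕ → Bool
m == n = ⌊ m ≟ n ⌋

==-true : ∀ {m n} → m ≡ n → (m == n) ≡ true
==-true {m} {n} m≡n = trans (isYes≗does (m ≟ n)) (dec-true (m ≟ n) m≡n)

==-false : ∀ {m n} → m ≢ n → (m == n) ≡ false
==-false {m} {n} m≢n = trans (isYes≗does (m ≟ n)) (dec-false (m ≟ n) m≢n)

==⇒≡ : ∀ {m n} → (m == n) ≡ true → m ≡ n
==⇒≡ {m} {n} e with m ≟ n
... | yes m≡n = m≡n

==-false⁻ : ∀ {m n} → (m == n) ≡ false → m ≢ n
==-false⁻ m=n m≡n with () ← trans (sym (==-true m≡n)) m=n

==-sym : ∀ m n → (m == n) ≡ (n == m)
==-sym m n = begin
  ⌊ m ≟ n ⌋  ≡⟨ isYes≗does (m ≟ n) ⟩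
  _          ≡⟨ does-⇔ (mk⇔ sym sym) (m ≟ n) (n ≟ m) ⟩
  _          ≡⟨ sym (isYes≗does (n ≟ m)) ⟩
  ⌊ n ≟ m ⌋  ∎

==-suc : ∀ m n → (suc m == suc n) ≡ (m == n)
==-suc m n = begin
  ⌊ suc m ≟ suc n ⌋  ≡⟨ isYes≗does (suc m ≟ suc n) ⟩
  _                  ≡⟨ does-⇔ (mk⇔ suc-injective (cong suc)) (suc m ≟ suc n) (m ≟ n) ⟩
  _                  ≡⟨ sym (isYes≗does (m ≟ n)) ⟩
  ⌊ m ≟ n ⌋          ∎

𝟙 : Bool → ℕ
𝟙 true  = 1
𝟙 false = 0

𝟙≤1 : ∀ b → 𝟙 b ≤ 1
𝟙≤1 true  = ≤-refl
𝟙≤1 false = z≤n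

𝟙-∧ : ∀ a b → 𝟙 (a ∧ b) ≡ 𝟙 a * 𝟙 b
𝟙-∧ true  b = sym (+-identityʳ _)
𝟙-∧ false b = refl

𝟙-not : ∀ b → 𝟙 (not b) + 𝟙 b ≡ 1
𝟙-not true  = refl
𝟙-not false = refl

𝟙-∨ : ∀ a b → (a ≡ true → b ≡ false) → 𝟙 (a ∨ b) ≡ 𝟙 a + 𝟙 b
𝟙-∨ true  b excl rewrite excl refl = refl
𝟙-∨ false b _ = refl

≤1⇒0⊎1 : ∀ {k} → k ≤ 1 → k ≡ 0 ⊎ k ≡ 1
≤1⇒0⊎1 z≤n       = inj₁ refl
≤1⇒0⊎1 (s≤s z≤n) = inj₂ refl

𝟙==*𝟙==≡0 : ∀ {x v x′ v′} → (x ≡ v → x′ ≡ v′ → ⊥) → 𝟙 (x == v) * 𝟙 (x′ == v′) ≡ 0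
𝟙==*𝟙==≡0 {x} {v} {x′} {v′} incompatible with x ≟ v | x′ ≟ v′
... | no  _   | _       = refl
... | yes _   | no _    = refl
... | yes x≡v | yes x′≡v′ = ⊥-elim (incompatible x≡v x′≡v′)

*-≢0 : ∀ {m n} → m ≢ 0 → n ≢ 0 → m * n ≢ 0
*-≢0 {m} m≢0 n≢0 mn≡0 with m*n≡0⇒m≡0∨n≡0 m mn≡0
... | inj₁ m≡0 = m≢0 m≡0
... | inj₂ n≡0 = n≢0 n≡0

∑ : (A → ℕ) → List A → ℕ
∑ f xs = sum (map f xs)

∏ : (A → ℕ) → List A → ℕ
∏ f xs = product (map f xs)

syntax ∑ (λ x → e) xs = ∑[ x ∈ xs ] e
syntax ∏ (λ x → e) xs = ∏[ x ∈ xs ] e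

length-filterᵇ : ∀ (p : A → Bool) xs → length (filterᵇ p xs) ≡ ∑[ x ∈ xs ] 𝟙 (p x)
length-filterᵇ p [] = refl
length-filterᵇ p (x ∷ xs) with p x
... | true  = cong suc (length-filterᵇ p xs)
... | false = length-filterᵇ p xs

∑-cong : ∀ {f g : A → ℕ} → (∀ x → f x ≡ g x) → ∀ xs → ∑ f xs ≡ ∑ g xs
∑-cong f≡g []       = refl
∑-cong f≡g (x ∷ xs) = cong₂ _+_ (f≡g x) (∑-cong f≡g xs)

∑-congᴬ : ∀ {P : A → Set} {f g : A → ℕ} {xs} → All P xs → (∀ {x} → P x → f x ≡ g x) → ∑ f xs ≡ ∑ g xs
∑-congᴬ []         f≡g = refl
∑-congᴬ (px ∷ pxs) f≡g = cong₂ _+_ (f≡g px) (∑-congᴬ pxs f≡g)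

∑-0 : ∀ (xs : List A) → ∑[ x ∈ xs ] 0 ≡ 0
∑-0 []       = refl
∑-0 (x ∷ xs) = ∑-0 xs

∑-++ : ∀ (f : A → ℕ) xs ys → ∑ f (xs ++ ys) ≡ ∑ f xs + ∑ f ys
∑-++ f xs ys = trans (cong sum (map-++ f xs ys)) (sum-++ (map f xs) (map f ys))

∏-++ : ∀ (f : A → ℕ) xs ys → ∏ f (xs ++ ys) ≡ ∏ f xs * ∏ f ys
∏-++ f xs ys = trans (cong product (map-++ f xs ys)) (product-++ (map f xs) (map f ys))

∑-+ : ∀ (f g : A → ℕ) xs → ∑[ x ∈ xs ] (f x + g x) ≡ ∑ f xs + ∑ g xs
∑-+ f g []       = refl
∑-+ f g (x ∷ xs) = trans (cong (f x + g x +_) (∑-+ f g xs)) (+-interchange (f x) (g x) _ _)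

∑-*ˡ : ∀ c (f : A → ℕ) xs → ∑[ x ∈ xs ] (c * f x) ≡ c * ∑ f xs
∑-*ˡ c f []       = sym (*-zeroʳ c)
∑-*ˡ c f (x ∷ xs) = trans (cong (c * f x +_) (∑-*ˡ c f xs)) (sym (*-distribˡ-+ c (f x) _))

∑-*ʳ : ∀ (f : A → ℕ) c xs → ∑[ x ∈ xs ] (f x * c) ≡ ∑ f xs * c
∑-*ʳ f c xs = trans (∑-cong (λ x → *-comm (f x) c) xs) (trans (∑-*ˡ c f xs) (*-comm c _))

∑-≤-length : ∀ {f : A → ℕ} → (∀ x → f x ≤ 1) → ∀ xs → ∑ f xs ≤ length xs
∑-≤-length f≤1 []       = z≤n
∑-≤-length f≤1 (x ∷ xs) = +-mono-≤ (f≤1 x) (∑-≤-length f≤1 xs)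

∑-map : ∀ (f : B → ℕ) (g : A → B) xs → ∑ f (map g xs) ≡ ∑[ x ∈ xs ] f (g x)
∑-map f g xs = cong sum (sym (map-∘ xs))

∏-map : ∀ (f : B → ℕ) (g : A → B) xs → ∏ f (map g xs) ≡ ∏[ x ∈ xs ] f (g x)
∏-map f g xs = cong product (sym (map-∘ xs))

∏-↭ : ∀ (f : A → ℕ) {xs ys} → xs ↭ ys → ∏ f xs ≡ ∏ f ys
∏-↭ f σ = product-↭ (↭-map⁺ f σ)

∑-concatMap : ∀ (f : B → ℕ) (g : A → List B) xs → ∑ f (concatMap g xs) ≡ ∑[ x ∈ xs ] ∑ f (g x)
∑-concatMap f g []       = refl
∑-concatMap f g (x ∷ xs) = trans (∑-++ f (g x) _) (cong (∑ f (g x) +_) (∑-concatMap f g xs))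

∑-comm : ∀ (f : A → B → ℕ) xs ys → ∑[ x ∈ xs ] ∑[ y ∈ ys ] f x y ≡ ∑[ y ∈ ys ] ∑[ x ∈ xs ] f x y
∑-comm f []       ys = sym (∑-0 ys)
∑-comm f (x ∷ xs) ys =
  trans (cong (∑ (f x) ys +_) (∑-comm f xs ys)) (sym (∑-+ (f x) (λ y → ∑[ x ∈ xs ] f x y) ys))

∑-upTo-suc : ∀ (f : ℕ → ℕ) n → ∑ f (upTo (suc n)) ≡ f 0 + ∑[ i ∈ upTo n ] f (suc i)
∑-upTo-suc f n = cong (λ xs → f 0 + sum xs) (trans (map-applyUpTo suc f n) (sym (map-upTo (λ i → f (suc i)) n)))

∑-upTo-cong : ∀ {f g : ℕ → ℕ} n → (∀ {i} → i < n → f i ≡ g i) → ∑ f (upTo n) ≡ ∑ g (upTo n)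
∑-upTo-cong n f≡g = ∑-congᴬ (all-upTo n) f≡g

∑-upTo-1 : ∀ n → ∑[ i ∈ upTo n ] 1 ≡ n
∑-upTo-1 zero    = refl
∑-upTo-1 (suc n) = trans (∑-upTo-suc (λ _ → 1) n) (cong suc (∑-upTo-1 n))

∑-δ : ∀ (h : ℕ → ℕ) {n p} → p < n → ∑[ i ∈ upTo n ] (𝟙 (i == p) * h i) ≡ h p
∑-δ h {suc n} {zero} _ = begin
  ∑[ i ∈ upTo (suc n) ] (𝟙 (i == 0) * h i)                ≡⟨ ∑-upTo-suc (λ i → 𝟙 (i == 0) * h i) n ⟩
  1 * h 0 + ∑[ i ∈ upTo n ] (𝟙 (suc i == 0) * h (suc i))  ≡⟨ cong (1 * h 0 +_) (∑-0 (upTo n)) ⟩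
  1 * h 0 + 0                                              ≡⟨ trans (+-identityʳ _) (*-identityˡ _) ⟩
  h 0                                                      ∎
∑-δ h {suc n} {suc p} (s≤s p<n) = begin
  ∑[ i ∈ upTo (suc n) ] (𝟙 (i == suc p) * h i)
    ≡⟨ ∑-upTo-suc (λ i → 𝟙 (i == suc p) * h i) n ⟩
  0 + ∑[ i ∈ upTo n ] (𝟙 (suc i == suc p) * h (suc i))
    ≡⟨ ∑-cong (λ i → cong (λ b → 𝟙 b * h (suc i)) (==-suc i p)) (upTo n) ⟩
  ∑[ i ∈ upTo n ] (𝟙 (i == p) * h (suc i))
    ≡⟨ ∑-δ (λ i → h (suc i)) p<n ⟩
  h (suc p) ∎

∑-δ-out : ∀ (h : ℕ → ℕ) {n p} → n ≤ p → ∑[ i ∈ upTo n ] (𝟙 (i == p) * h i) ≡ 0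
∑-δ-out h {n} n≤p =
  trans (∑-upTo-cong n (λ i<n → cong (λ b → 𝟙 b * h _) (==-false (<⇒≢ (<-≤-trans i<n n≤p))))) (∑-0 (upTo n))

𝟙-∑≡length : ∀ {f : A → ℕ} → (∀ x → f x ≤ 1) → ∀ xs → 𝟙 (∑ f xs == length xs) ≡ ∏ f xs
𝟙-∑≡length f≤1 [] = refl
𝟙-∑≡length {f = f} f≤1 (x ∷ xs) with ≤1⇒0⊎1 (f≤1 x)
... | inj₁ fx≡0 rewrite fx≡0 = cong 𝟙 (==-false λ eq → <-irrefl eq (s≤s (∑-≤-length f≤1 xs)))
... | inj₂ fx≡1 rewrite fx≡1 =
  trans (cong 𝟙 (==-suc (∑ f xs) (length xs))) (trans (𝟙-∑≡length f≤1 xs) (sym (+-identityʳ _)))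

∑-exclusive≤1 : ∀ {P : A → Set} (f : A → ℕ) → (∀ x → f x ≤ 1) → (∀ {x y} → P x → P y → x ≢ y → f x * f y ≡ 0) →
                ∀ {xs} → All P xs → Unique xs → ∑ f xs ≤ 1
∑-exclusive≤1 f f≤1 excl [] [] = z≤n
∑-exclusive≤1 {P = P} f f≤1 excl {x ∷ xs} (px ∷ pxs) (x∉ ∷ u) with ≤1⇒0⊎1 (f≤1 x)
... | inj₁ fx≡0 rewrite fx≡0 = ∑-exclusive≤1 f f≤1 excl pxs u
... | inj₂ fx≡1 rewrite fx≡1 =
  ≤-reflexive (cong suc (trans (∑-congᴬ (All.zipWith (λ (py , x≢y) → others-vanish py x≢y) (pxs , x∉)) id) (∑-0 xs)))
  where
  others-vanish : ∀ {y} → P y → x ≢ y → f y ≡ 0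
  others-vanish {y} py x≢y = trans (sym (+-identityʳ (f y))) (trans (cong (_* f y) (sym fx≡1)) (excl px py x≢y))

All-at : ∀ {P : ℕ → Set} {xs} → All P xs → ∀ {p} → p < length xs → P (at xs p)
All-at (px ∷ pxs) {zero}  _         = px
All-at (px ∷ pxs) {suc p} (s≤s p<) = All-at pxs p<

at-injective : ∀ {xs} → Unique xs → ∀ {p q} → p < length xs → q < length xs → at xs p ≡ at xs q → p ≡ q
at-injective (x∉ ∷ u) {zero}  {zero}  _        _        _ = refl
at-injective (x∉ ∷ u) {zero}  {suc q} _        (s≤s q<) e = ⊥-elim (All-at x∉ q< e)
at-injective (x∉ ∷ u) {suc p} {zero}  (s≤s p<) _        e = ⊥-elim (All-at x∉ p< (sym e))
at-injective (x∉ ∷ u) {suc p} {suc q} (s≤s p<) (s≤s q<) e = cong suc (at-injective u p< q< e)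

IsArrangement : ℕ → List ℕ → Set
IsArrangement n π = length π ≡ n × Unique π × All (_< n) π

ins : List ℕ → ℕ → ℕ → List ℕ
ins xs       zero    x = x ∷ xs
ins []       (suc r) x = x ∷ []
ins (y ∷ ys) (suc r) x = y ∷ ins ys r x

insertAt≡ins : ∀ xs (i : Fin (suc (length xs))) x → insertAt xs i x ≡ ins xs (toℕ i) x
insertAt≡ins xs       fzero    x = refl
insertAt≡ins (y ∷ ys) (fsuc i) x = cong (y ∷_) (insertAt≡ins ys i x)

length-ins : ∀ xs {r} x → r ≤ length xs → length (ins xs r x) ≡ suc (length xs)
length-ins xs       {zero}  x _        = refl
length-ins (y ∷ ys) {suc r} x (s≤s r≤) = cong suc (length-ins ys x r≤)

All-ins : ∀ {P : ℕ → Set} {xs} r {x} → P x → All P xs → All P (ins xs r x)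
All-ins zero    px pxs          = px ∷ pxs
All-ins (suc r) px []           = px ∷ []
All-ins (suc r) px (py ∷ pys) = py ∷ All-ins r px pys

Unique-ins : ∀ {xs} r {x} → Unique xs → All (x ≢_) xs → Unique (ins xs r x)
Unique-ins zero    u          x∉         = x∉ ∷ u
Unique-ins (suc r) []         x∉         = [] ∷ []
Unique-ins (suc r) (y∉ ∷ u) (x≢y ∷ x∉) = All-ins r (≢-sym x≢y) y∉ ∷ Unique-ins r u x∉

punchOut : ℕ → ℕ → ℕ
punchOut zero    p       = p ∸ 1
punchOut (suc r) zero    = zero
punchOut (suc r) (suc p) = suc (punchOut r p)

at-ins-≡ : ∀ xs {r} x → r ≤ length xs → at (ins xs r x) r ≡ x
at-ins-≡ xs       {zero}  x _        = refl
at-ins-≡ (y ∷ ys) {suc r} x (s≤s r≤) = at-ins-≡ ys x r≤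

at-ins-≢ : ∀ xs {r} x {p} → r ≢ p → r ≤ length xs → at (ins xs r x) p ≡ at xs (punchOut r p)
at-ins-≢ xs       {zero}  x {zero}  r≢p _        = ⊥-elim (r≢p refl)
at-ins-≢ xs       {zero}  x {suc p} _   _        = refl
at-ins-≢ (y ∷ ys) {suc r} x {zero}  _   _        = refl
at-ins-≢ (y ∷ ys) {suc r} x {suc p} r≢p (s≤s r≤) = at-ins-≢ ys x (λ e → r≢p (cong suc e)) r≤

punchOut-< : ∀ {m r p} → p < suc m → r ≢ p → r ≤ m → punchOut r p < m
punchOut-< {m}     {zero}  {zero}  _        r≢p _        = ⊥-elim (r≢p refl)
punchOut-< {m}     {zero}  {suc p} (s≤s p<) _   _        = p<
punchOut-< {suc m} {suc r} {zero}  _        _   _        = s≤s z≤n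
punchOut-< {suc m} {suc r} {suc p} (s≤s p<) r≢p (s≤s r≤) = s≤s (punchOut-< p< (λ e → r≢p (cong suc e)) r≤)

punchOut-injective : ∀ {r p q} → r ≢ p → r ≢ q → punchOut r p ≡ punchOut r q → p ≡ q
punchOut-injective {zero}  {zero}  {q}     r≢p _   _ = ⊥-elim (r≢p refl)
punchOut-injective {zero}  {suc p} {zero}  _   r≢q _ = ⊥-elim (r≢q refl)
punchOut-injective {zero}  {suc p} {suc q} _   _   e = cong suc e
punchOut-injective {suc r} {zero}  {zero}  _   _   _ = refl
punchOut-injective {suc r} {suc p} {suc q} r≢p r≢q e =
  cong suc (punchOut-injective (λ e′ → r≢p (cong suc e′)) (λ e′ → r≢q (cong suc e′)) (suc-injective e))

perms-arrangement : ∀ n → All (IsArrangement n) (perms n)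
perms-arrangement zero    = (refl , [] , []) ∷ []
perms-arrangement (suc m) = concat⁺ (map⁺ (All.map insertions-arrangement (perms-arrangement m)))
  where
  insertions-arrangement : ∀ {π} → IsArrangement m π → All (IsArrangement (suc m)) (insertions m π)
  insertions-arrangement {π} (len , u , π<m) = map⁺ (tabulate⁺ λ i →
    let r≤ = ≤-pred (toℕ<n i) in
    subst (IsArrangement (suc m)) (sym (insertAt≡ins π i m))
      ( trans (length-ins π m r≤) (cong suc len)
      , Unique-ins (toℕ i) u (All.map (λ v<m m≡v → <-irrefl (sym m≡v) v<m) π<m)
      , All-ins (toℕ i) ≤-refl (All.map m≤n⇒m≤1+n π<m)))

∑-tabulate : ∀ {k} (f : A → ℕ) (F : Fin k → A) (g : ℕ → ℕ) →
             (∀ i → f (F i) ≡ g (toℕ i)) → ∑ f (tabulate F) ≡ ∑ g (upTo k)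
∑-tabulate {k = zero}  f F g e = refl
∑-tabulate {k = suc k} f F g e =
  trans (cong₂ _+_ (e fzero) (∑-tabulate f (λ i → F (fsuc i)) (λ i → g (suc i)) (λ i → e (fsuc i))))
        (sym (∑-upTo-suc g k))

∑-insertions : ∀ (f : List ℕ → ℕ) π x → ∑ f (insertions x π) ≡ ∑[ r ∈ upTo (suc (length π)) ] f (ins π r x)
∑-insertions f π x = trans (∑-map f (λ i → insertAt π i x) (allFin _))
  (∑-tabulate (λ i → f (insertAt π i x)) (λ i → i) _ (λ i → cong f (insertAt≡ins π i x)))

infix 4 _∈ᵇ_
_∈ᵇ_ : ℕ → List ℕ → Bool
x ∈ᵇ []       = false
x ∈ᵇ (y ∷ ys) = (x == y) ∨ (x ∈ᵇ ys)

∈ᵇ-false : ∀ {x ys} → All (x ≢_) ys → (x ∈ᵇ ys) ≡ false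
∈ᵇ-false []                = refl
∈ᵇ-false (x≢y ∷ x∉) rewrite ==-false x≢y = ∈ᵇ-false x∉

∈ᵇ-false⁻ : ∀ {x} ys → (x ∈ᵇ ys) ≡ false → All (x ≢_) ys
∈ᵇ-false⁻         []       _ = []
∈ᵇ-false⁻ {x} (y ∷ ys) e with x == y in x=y
... | false = ==-false⁻ x=y ∷ ∈ᵇ-false⁻ ys e

∑-∈ᵇ : ∀ {M ps} → Unique ps → All (_< M) ps → ∑[ r ∈ upTo M ] 𝟙 (r ∈ᵇ ps) ≡ length ps
∑-∈ᵇ {M} {[]}     []         []          = ∑-0 (upTo M)
∑-∈ᵇ {M} {p ∷ ps} (p∉ ∷ u) (p<M ∷ ps<M) = begin
  ∑[ r ∈ upTo M ] 𝟙 (r ∈ᵇ p ∷ ps)                              ≡⟨ ∑-cong split (upTo M) ⟩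
  ∑[ r ∈ upTo M ] (𝟙 (r == p) + 𝟙 (r ∈ᵇ ps))                  ≡⟨ ∑-+ _ _ (upTo M) ⟩
  ∑[ r ∈ upTo M ] 𝟙 (r == p) + ∑[ r ∈ upTo M ] 𝟙 (r ∈ᵇ ps)   ≡⟨ cong₂ _+_ single (∑-∈ᵇ u ps<M) ⟩
  suc (length ps)                                               ∎
  where
  split : ∀ r → 𝟙 (r ∈ᵇ p ∷ ps) ≡ 𝟙 (r == p) + 𝟙 (r ∈ᵇ ps)
  split r = 𝟙-∨ (r == p) (r ∈ᵇ ps) (λ r=p → subst (λ z → (z ∈ᵇ ps) ≡ false) (sym (==⇒≡ r=p)) (∈ᵇ-false p∉))
  single : ∑[ r ∈ upTo M ] 𝟙 (r == p) ≡ 1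
  single = trans (∑-cong (λ r → sym (*-identityʳ (𝟙 (r == p)))) (upTo M)) (∑-δ (λ _ → 1) p<M)

∑-∉ᵇ : ∀ {M ps} → Unique ps → All (_< M) ps → ∑[ r ∈ upTo M ] 𝟙 (not (r ∈ᵇ ps)) ≡ M ∸ length ps
∑-∉ᵇ {M} {ps} u ps<M = begin
  outside                         ≡⟨ sym (m+n∸n≡m outside (length ps)) ⟩
  outside + length ps ∸ length ps ≡⟨ cong (_∸ length ps) outside+inside ⟩
  M ∸ length ps                   ∎
  where
  outside = ∑[ r ∈ upTo M ] 𝟙 (not (r ∈ᵇ ps))
  outside+inside : outside + length ps ≡ M
  outside+inside = begin
    outside + length ps                                   ≡⟨ cong (outside +_) (sym (∑-∈ᵇ u ps<M)) ⟩
    outside + ∑[ r ∈ upTo M ] 𝟙 (r ∈ᵇ ps)                 ≡⟨ sym (∑-+ _ _ (upTo M)) ⟩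
    ∑[ r ∈ upTo M ] (𝟙 (not (r ∈ᵇ ps)) + 𝟙 (r ∈ᵇ ps))   ≡⟨ ∑-cong (λ r → 𝟙-not (r ∈ᵇ ps)) (upTo M) ⟩
    ∑[ r ∈ upTo M ] 1                                     ≡⟨ ∑-upTo-1 M ⟩
    M                                                     ∎

Unique-length-≤ : ∀ {M ps} → Unique ps → All (_< M) ps → length ps ≤ M
Unique-length-≤ {M} {ps} u ps<M =
  subst₂ _≤_ (∑-∈ᵇ u ps<M) (length-upTo M) (∑-≤-length (λ r → 𝟙≤1 (r ∈ᵇ ps)) (upTo M))

Unique-map-injectiveOn : ∀ {P : A → Set} (f : A → B) → (∀ {x y} → P x → P y → f x ≡ f y → x ≡ y) →
                         ∀ {xs} → All P xs → Unique xs → Unique (map f xs)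
Unique-map-injectiveOn f inj [] [] = []
Unique-map-injectiveOn {P = P} f inj {x ∷ _} (px ∷ pxs) (x∉ ∷ u) = fx∉ pxs x∉ ∷ Unique-map-injectiveOn f inj pxs u
  where
  fx∉ : ∀ {ys} → All P ys → All (x ≢_) ys → All (f x ≢_) (map f ys)
  fx∉ []           []           = []
  fx∉ (py ∷ pys) (x≢y ∷ x∉) = (λ fx≡fy → x≢y (inj px py fx≡fy)) ∷ fx∉ pys x∉

doubled : (A → B) → (A → B) → List A → List B
doubled f g = concatMap (λ x → f x ∷ g x ∷ [])

All-doubled : ∀ {R : B → Set} (f g : A → B) {xs} → All (λ x → R (f x) × R (g x)) xs → All R (doubled f g xs)
All-doubled f g []                 = []
All-doubled f g ((rf , rg) ∷ rxs) = rf ∷ rg ∷ All-doubled f g rxs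

module _ {P : A → Set} (f g : A → B)
         (f-injective : ∀ {x y} → f x ≡ f y → x ≡ y) (g-injective : ∀ {x y} → g x ≡ g y → x ≡ y)
         (disjoint : ∀ {x y} → P x → P y → f x ≢ g y) where

  private
    doubled-∉ : ∀ {x} z → (∀ {y} → P y → x ≢ y → z ≢ f y × z ≢ g y) →
                ∀ {ys} → All P ys → All (x ≢_) ys → All (z ≢_) (doubled f g ys)
    doubled-∉ z z∉ pys x∉ = All-doubled f g (All.zipWith (λ (py , x≢y) → z∉ py x≢y) (pys , x∉))

  Unique-doubled : ∀ {xs} → All P xs → Unique xs → Unique (doubled f g xs)
  Unique-doubled []         []         = []
  Unique-doubled (px ∷ pxs) (x∉ ∷ u) =
      (disjoint px px ∷ doubled-∉ (f _) (λ py x≢y → (λ fx≡fy → x≢y (f-injective fx≡fy)) , disjoint px py) pxs x∉)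
    ∷ doubled-∉ (g _) (λ py x≢y → (λ gx≡fy → disjoint py px (sym gx≡fy)) , (λ gx≡gy → x≢y (g-injective gx≡gy))) pxs x∉
    ∷ Unique-doubled pxs u

Assignment : Set
Assignment = List (ℕ × ℕ)

IsPartialMatching : ℕ → ℕ → List (ℕ × ℕ) → Set
IsPartialMatching L M ps =
  Unique (map proj₁ ps) × Unique (map proj₂ ps) × All (_< L) (map proj₁ ps) × All (_< M) (map proj₂ ps)

positions values : Assignment → List ℕ
positions = map proj₁
values    = map proj₂

satisfies : Assignment → List ℕ → ℕ
satisfies cs π = ∏[ c ∈ cs ] 𝟙 (at π (proj₁ c) == proj₂ c)

satisfies-concatMap : ∀ (cells : A → Assignment) π xs →
                      ∏[ x ∈ xs ] satisfies (cells x) π ≡ satisfies (concatMap cells xs) π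
satisfies-concatMap cells π []       = refl
satisfies-concatMap cells π (x ∷ xs) =
  trans (cong (satisfies (cells x) π *_) (satisfies-concatMap cells π xs))
        (sym (∏-++ _ (cells x) (concatMap cells xs)))

satisfies≤1 : ∀ cs π → satisfies cs π ≤ 1
satisfies≤1 []       π = ≤-refl
satisfies≤1 (c ∷ cs) π = *-mono-≤ (𝟙≤1 (at π (proj₁ c) == proj₂ c)) (satisfies≤1 cs π)

IsPartialMatching-↭ : ∀ {L M ps qs} → ps ↭ qs → IsPartialMatching L M ps → IsPartialMatching L M qs
IsPartialMatching-↭ σ (uP , uV , P< , V<) =
  let σP = ↭-map⁺ proj₁ σ ; σV = ↭-map⁺ proj₂ σ in
  Unique-resp-↭ (↭⇒↭ₛ σP) uP , Unique-resp-↭ (↭⇒↭ₛ σV) uV , All-resp-↭ σP P< , All-resp-↭ σV V<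

∈ᵇ-values⇒↭ : ∀ {x} cs → (x ∈ᵇ values cs) ≡ true → ∃₂ λ p cs′ → cs ↭ (p , x) ∷ cs′
∈ᵇ-values⇒↭ {x} ((p , v) ∷ cs) x∈ with x == v in x=v
... | true rewrite ==⇒≡ x=v = p , cs , ↭-refl
... | false with ∈ᵇ-values⇒↭ cs x∈
...   | q , cs′ , σ = q , (p , v) ∷ cs′ , ↭-trans (↭-prep (p , v) σ) (↭-swap (p , v) (q , x) ↭-refl)

punchOutPositions : ℕ → Assignment → Assignment
punchOutPositions r = map (map₁ (punchOut r))

satisfies-ins : ∀ π {r} x cs → All (x ≢_) (values cs) → r ≤ length π →
                satisfies cs (ins π r x) ≡ 𝟙 (not (r ∈ᵇ positions cs)) * satisfies (punchOutPositions r cs) π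
satisfies-ins π x [] _ _ = refl
satisfies-ins π {r} x ((p , v) ∷ cs) (x≢v ∷ x∉) r≤ with r == p in r=p
... | true rewrite sym (==⇒≡ r=p) | at-ins-≡ π x r≤ | ==-false x≢v = refl
... | false rewrite at-ins-≢ π x (==-false⁻ r=p) r≤ | satisfies-ins π x cs x∉ r≤ =
  *-left-comm (𝟙 (at π (punchOut r p) == v)) (𝟙 (not (r ∈ᵇ positions cs))) _

IsPartialMatching-punchOut : ∀ {m r cs} → IsPartialMatching (suc m) (suc m) cs → r ≤ m →
                             All (r ≢_) (positions cs) → All (m ≢_) (values cs) →
                             IsPartialMatching m m (punchOutPositions r cs)
IsPartialMatching-punchOut {m} {r} {cs} (uP , uV , P< , V<) r≤m r∉ m∉ =
    subst Unique (sym positions-eq) (Unique-map-injectiveOn (punchOut r) punchOut-injective r∉ uP)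
  , subst Unique (sym values-eq) uV
  , subst (All (_< m)) (sym positions-eq) (map⁺ (All.zipWith (λ (p< , r≢p) → punchOut-< p< r≢p r≤m) (P< , r∉)))
  , subst (All (_< m)) (sym values-eq) (All.zipWith (λ (v< , m≢v) → ≤∧≢⇒< (≤-pred v<) (≢-sym m≢v)) (V< , m∉))
  where
  positions-eq : positions (punchOutPositions r cs) ≡ map (punchOut r) (positions cs)
  positions-eq = trans (sym (map-∘ cs)) (map-∘ cs)
  values-eq : values (punchOutPositions r cs) ≡ values cs
  values-eq = sym (map-∘ cs)

at-ins-max : ∀ {m π} → IsArrangement m π → ∀ {r p} → r ≤ m → p ≤ m → (at (ins π r m) p == m) ≡ (r == p)
at-ins-max {m} {π} (len , _ , π<m) {r} {p} r≤m p≤m with r ≟ p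
... | yes refl = ==-true (at-ins-≡ π m (subst (r ≤_) (sym len) r≤m))
... | no  r≢p  = ==-false λ πp≡m → <-irrefl πp≡m (subst (_< m) (sym (at-ins-≢ π m r≢p (subst (r ≤_) (sym len) r≤m)))
                   (All-at π<m (subst (punchOut r p <_) (sym len) (punchOut-< (s≤s p≤m) r≢p r≤m))))

∑-perms-suc : ∀ m (f : List ℕ → ℕ) → ∑ f (perms (suc m)) ≡ ∑[ π ∈ perms m ] ∑[ r ∈ upTo (suc m) ] f (ins π r m)
∑-perms-suc m f = trans (∑-concatMap f (insertions m) (perms m)) (∑-congᴬ (perms-arrangement m) λ {π} arr →
  trans (∑-insertions f π m) (cong (λ L → ∑[ r ∈ upTo (suc L) ] f (ins π r m)) (proj₁ arr)))

module _ {m : ℕ} (ih : ∀ {D} → IsPartialMatching m m D → ∑[ π ∈ perms m ] satisfies D π ≡ (m ∸ length D) !) where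

  ∑-perms-satisfies-free : ∀ {cs} → IsPartialMatching (suc m) (suc m) cs → All (m ≢_) (values cs) →
                           ∑[ π ∈ perms (suc m) ] satisfies cs π ≡ (suc m ∸ length cs) !
  ∑-perms-satisfies-free {cs} match@(uP , uV , P< , V<) m∉ = begin
    ∑[ π ∈ perms (suc m) ] satisfies cs π
      ≡⟨ ∑-perms-suc m (satisfies cs) ⟩
    ∑[ π ∈ perms m ] ∑[ r ∈ upTo (suc m) ] satisfies cs (ins π r m)
      ≡⟨ ∑-congᴬ (perms-arrangement m) (λ arr → ∑-upTo-cong (suc m) λ r< →
           satisfies-ins _ m cs m∉ (subst (_ ≤_) (sym (proj₁ arr)) (≤-pred r<))) ⟩
    ∑[ π ∈ perms m ] ∑[ r ∈ upTo (suc m) ] (𝟙 (not (r ∈ᵇ positions cs)) * satisfies (punchOutPositions r cs) π)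
      ≡⟨ ∑-comm _ (perms m) (upTo (suc m)) ⟩
    ∑[ r ∈ upTo (suc m) ] ∑[ π ∈ perms m ] (𝟙 (not (r ∈ᵇ positions cs)) * satisfies (punchOutPositions r cs) π)
      ≡⟨ ∑-upTo-cong (suc m) (λ {r} r< →
           trans (∑-*ˡ (𝟙 (not (r ∈ᵇ positions cs))) (satisfies (punchOutPositions r cs)) (perms m))
                 (count-punchedOut r<)) ⟩
    ∑[ r ∈ upTo (suc m) ] (𝟙 (not (r ∈ᵇ positions cs)) * (m ∸ length cs) !)
      ≡⟨ ∑-*ʳ (λ r → 𝟙 (not (r ∈ᵇ positions cs))) _ (upTo (suc m)) ⟩
    ∑[ r ∈ upTo (suc m) ] 𝟙 (not (r ∈ᵇ positions cs)) * (m ∸ length cs) !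
      ≡⟨ cong (_* (m ∸ length cs) !) (trans (∑-∉ᵇ uP P<) (cong (suc m ∸_) (length-map proj₁ cs))) ⟩
    (suc m ∸ length cs) * (m ∸ length cs) !
      ≡⟨ cong (_* (m ∸ length cs) !) (+-∸-assoc 1 |cs|≤m) ⟩
    suc (m ∸ length cs) !
      ≡⟨ cong _! (sym (+-∸-assoc 1 |cs|≤m)) ⟩
    (suc m ∸ length cs) ! ∎
    where
    |cs|≤m : length cs ≤ m
    |cs|≤m = subst (_≤ m) (length-map proj₂ cs)
      (Unique-length-≤ uV (All.zipWith (λ (v< , m≢v) → ≤∧≢⇒< (≤-pred v<) (≢-sym m≢v)) (V< , m∉)))
    count-punchedOut : ∀ {r} → r < suc m →
      𝟙 (not (r ∈ᵇ positions cs)) * ∑[ π ∈ perms m ] satisfies (punchOutPositions r cs) π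
        ≡ 𝟙 (not (r ∈ᵇ positions cs)) * (m ∸ length cs) !
    count-punchedOut {r} r< with r ∈ᵇ positions cs in r∈?
    ... | true  = refl
    ... | false = cong (1 *_) (trans (ih (IsPartialMatching-punchOut match (≤-pred r<) r∉ m∉))
                                     (cong (λ k → (m ∸ k) !) (length-map _ cs)))
      where r∉ = ∈ᵇ-false⁻ (positions cs) r∈?

  ∑-perms-satisfies-forced : ∀ {p cs} → IsPartialMatching (suc m) (suc m) ((p , m) ∷ cs) →
                             ∑[ π ∈ perms (suc m) ] satisfies ((p , m) ∷ cs) π ≡ (m ∸ length cs) !
  ∑-perms-satisfies-forced {p} {cs} (p∉ ∷ uP , m∉ ∷ uV , p< ∷ P< , _ ∷ V<) = begin
    ∑[ π ∈ perms (suc m) ] satisfies ((p , m) ∷ cs) π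
      ≡⟨ ∑-perms-suc m _ ⟩
    ∑[ π ∈ perms m ] ∑[ r ∈ upTo (suc m) ] (𝟙 (at (ins π r m) p == m) * satisfies cs (ins π r m))
      ≡⟨ ∑-congᴬ (perms-arrangement m) (λ arr → ∑-upTo-cong (suc m) λ r< →
           cong (λ b → 𝟙 b * _) (at-ins-max arr (≤-pred r<) (≤-pred p<))) ⟩
    ∑[ π ∈ perms m ] ∑[ r ∈ upTo (suc m) ] (𝟙 (r == p) * satisfies cs (ins π r m))
      ≡⟨ ∑-cong (λ π → ∑-δ (λ r → satisfies cs (ins π r m)) p<) (perms m) ⟩
    ∑[ π ∈ perms m ] satisfies cs (ins π p m)
      ≡⟨ ∑-congᴬ (perms-arrangement m) (λ {π} arr →
           trans (satisfies-ins π m cs m∉ (subst (p ≤_) (sym (proj₁ arr)) (≤-pred p<)))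
                 (trans (cong (λ b → 𝟙 (not b) * satisfies (punchOutPositions p cs) π) (∈ᵇ-false p∉))
                        (+-identityʳ _))) ⟩
    ∑[ π ∈ perms m ] satisfies (punchOutPositions p cs) π
      ≡⟨ ih (IsPartialMatching-punchOut (uP , uV , P< , V<) (≤-pred p<) p∉ m∉) ⟩
    (m ∸ length (punchOutPositions p cs)) !
      ≡⟨ cong (λ k → (m ∸ k) !) (length-map _ cs) ⟩
    (m ∸ length cs) ! ∎

-- Insert the largest value m of an arrangement of m + 1: if some constraint asks for value m, its
-- position is forced; otherwise m may go to any of the m + 1 − |cs| unconstrained positions.
∑-perms-satisfies : ∀ n {cs} → IsPartialMatching n n cs → ∑[ π ∈ perms n ] satisfies cs π ≡ (n ∸ length cs) !
∑-perms-satisfies zero    {[]}    _                    = refl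
∑-perms-satisfies zero    {_ ∷ _} (_ , _ , () ∷ _ , _)
∑-perms-satisfies (suc m) {cs} match with m ∈ᵇ values cs in m∈?
... | false = ∑-perms-satisfies-free (∑-perms-satisfies m) match (∈ᵇ-false⁻ (values cs) m∈?)
... | true with ∈ᵇ-values⇒↭ cs m∈?
...   | p , cs′ , σ = begin
  ∑[ π ∈ perms (suc m) ] satisfies cs π
    ≡⟨ ∑-cong (λ π → ∏-↭ _ σ) (perms (suc m)) ⟩
  ∑[ π ∈ perms (suc m) ] satisfies ((p , m) ∷ cs′) π
    ≡⟨ ∑-perms-satisfies-forced (∑-perms-satisfies m) (IsPartialMatching-↭ σ match) ⟩
  (m ∸ length cs′) !
    ≡⟨ cong (λ k → (suc m ∸ k) !) (sym (↭-length σ)) ⟩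
  (suc m ∸ length cs) ! ∎

sequences : List B → ℕ → List (List B)
sequences vs zero    = [] ∷ []
sequences vs (suc L) = concatMap (λ v → map (v ∷_) (sequences vs L)) vs

sequences-shape : ∀ {P : B → Set} {vs} L → All P vs → All (λ s → length s ≡ L × All P s) (sequences vs L)
sequences-shape zero    _   = (refl , []) ∷ []
sequences-shape (suc L) pvs =
  concat⁺ (map⁺ (All.map (λ pv → map⁺ (All.map (λ (len , ps) → cong suc len , pv ∷ ps) (sequences-shape L pvs))) pvs))

∏-∑-expand : ∀ (h : A → B → ℕ) as vs →
             ∏[ a ∈ as ] ∑[ v ∈ vs ] h a v ≡ ∑[ s ∈ sequences vs (length as) ] ∏ (uncurry h) (zip as s)
∏-∑-expand h []       vs = refl
∏-∑-expand h (a ∷ as) vs = begin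
  ∑[ v ∈ vs ] h a v * ∏[ a ∈ as ] ∑[ v ∈ vs ] h a v                   ≡⟨ cong (∑ (h a) vs *_) (∏-∑-expand h as vs) ⟩
  ∑[ v ∈ vs ] h a v * ∑[ s ∈ Ss ] ∏ (uncurry h) (zip as s)            ≡⟨ sym (∑-*ʳ (h a) _ vs) ⟩
  ∑[ v ∈ vs ] (h a v * ∑[ s ∈ Ss ] ∏ (uncurry h) (zip as s))          ≡⟨ ∑-cong (λ v → sym (∑-*ˡ (h a v) _ Ss)) vs ⟩
  ∑[ v ∈ vs ] ∑[ s ∈ Ss ] (h a v * ∏ (uncurry h) (zip as s))          ≡⟨ ∑-cong (λ v → sym (∑-map _ (v ∷_) Ss)) vs ⟩
  ∑[ v ∈ vs ] ∑[ s ∈ map (v ∷_) Ss ] ∏ (uncurry h) (zip (a ∷ as) s)  ≡⟨ sym (∑-concatMap _ (λ v → map (v ∷_) Ss) vs) ⟩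
  ∑[ s ∈ sequences vs (suc (length as)) ] ∏ (uncurry h) (zip (a ∷ as) s) ∎
  where Ss = sequences vs (length as)

distinct : List ℕ → Bool
distinct []       = true
distinct (x ∷ xs) = not (x ∈ᵇ xs) ∧ distinct xs

distinct⇒Unique : ∀ s → distinct s ≡ true → Unique s
distinct⇒Unique []       _ = []
distinct⇒Unique (x ∷ xs) d with x ∈ᵇ xs in x∈ | distinct xs in dxs
... | false | true = ∈ᵇ-false⁻ xs x∈ ∷ distinct⇒Unique xs dxs

∑-distinct-sequences : ∀ M L → ∑[ s ∈ sequences (upTo M) L ] 𝟙 (distinct s) ≡ M P′ L
∑-distinct-sequences M zero    = refl
∑-distinct-sequences M (suc L) = begin
  ∑[ s ∈ sequences (upTo M) (suc L) ] 𝟙 (distinct s)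
    ≡⟨ ∑-concatMap _ (λ v → map (v ∷_) Ss) (upTo M) ⟩
  ∑[ v ∈ upTo M ] ∑[ s ∈ map (v ∷_) Ss ] 𝟙 (distinct s)
    ≡⟨ ∑-cong (λ v → trans (∑-map _ (v ∷_) Ss) (∑-cong (λ s → 𝟙-∧ (not (v ∈ᵇ s)) (distinct s)) Ss)) (upTo M) ⟩
  ∑[ v ∈ upTo M ] ∑[ s ∈ Ss ] (𝟙 (not (v ∈ᵇ s)) * 𝟙 (distinct s))
    ≡⟨ ∑-comm _ (upTo M) Ss ⟩
  ∑[ s ∈ Ss ] ∑[ v ∈ upTo M ] (𝟙 (not (v ∈ᵇ s)) * 𝟙 (distinct s))
    ≡⟨ ∑-cong (λ s → ∑-*ʳ (λ v → 𝟙 (not (v ∈ᵇ s))) _ (upTo M)) Ss ⟩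
  ∑[ s ∈ Ss ] (∑[ v ∈ upTo M ] 𝟙 (not (v ∈ᵇ s)) * 𝟙 (distinct s))
    ≡⟨ ∑-congᴬ (sequences-shape L (all-upTo M)) free-values ⟩
  ∑[ s ∈ Ss ] ((M ∸ L) * 𝟙 (distinct s))
    ≡⟨ ∑-*ˡ (M ∸ L) _ Ss ⟩
  (M ∸ L) * ∑[ s ∈ Ss ] 𝟙 (distinct s)
    ≡⟨ cong ((M ∸ L) *_) (∑-distinct-sequences M L) ⟩
  M P′ suc L ∎
  where
  Ss = sequences (upTo M) L
  free-values : ∀ {s} → length s ≡ L × All (_< M) s →
                ∑[ v ∈ upTo M ] 𝟙 (not (v ∈ᵇ s)) * 𝟙 (distinct s) ≡ (M ∸ L) * 𝟙 (distinct s)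
  free-values {s} (len , s<M) with distinct s in ds
  ... | false = trans (*-zeroʳ (∑[ v ∈ upTo M ] 𝟙 (not (v ∈ᵇ s)))) (sym (*-zeroʳ (M ∸ L)))
  ... | true  = cong (_* 1) (trans (∑-∉ᵇ (distinct⇒Unique s ds) s<M) (cong (M ∸_) len))

k!*nCk≡nP′k : ∀ {n k} → k ≤ n → k ! * (n C k) ≡ n P′ k
k!*nCk≡nP′k {n} {k} k≤n = begin
  k ! * (n C k)                           ≡⟨ cong (k ! *_) (nCk≡nPk/k! k≤n) ⟩
  k ! * ((n Combinatorics.P k) / k !)     ≡⟨ cong (λ t → k ! * (t / k !)) nPk≡nP′k ⟩
  k ! * ((n P′ k) / k !)                  ≡⟨ m*[n/m]≡n (k!∣nP′k k≤n) ⟩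
  n P′ k                                  ∎
  where
  instance _ = k !≢0
  nPk≡nP′k : n Combinatorics.P k ≡ n P′ k
  nPk≡nP′k with k ≤ᵇ n | ≤⇒≤ᵇ k≤n
  ... | true | _ = refl

nP′k≢0 : ∀ {n k} → k ≤ n → n P′ k ≢ 0
nP′k≢0 {k = zero}      _   ()
nP′k≢0 {n} {k = suc k} k<n eq with m*n≡0⇒m≡0∨n≡0 (n ∸ k) eq
... | inj₁ n∸k≡0 = <-irrefl (sym n∸k≡0) (m<n⇒0<n∸m k<n)
... | inj₂ nP′k≡0 = nP′k≢0 (<⇒≤ k<n) nP′k≡0

nCk≢0 : ∀ {n k} → k ≤ n → n C k ≢ 0
nCk≢0 {n} {k} k≤n nCk≡0 = nP′k≢0 k≤n (trans (sym (k!*nCk≡nP′k k≤n)) (trans (cong (k ! *_) nCk≡0) (*-zeroʳ (k !))))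

∈ᵇ-zip-∣ : ∀ (h : A → ℕ → ℕ) {x} xs as → (x ∈ᵇ xs) ≡ true → length xs ≡ length as →
           ∃ λ a′ → a′ ∈ as × h a′ x ∣ ∏ (uncurry h) (zip as xs)
∈ᵇ-zip-∣ h {x} (y ∷ ys) (a ∷ as) x∈ len with x == y in x=y
... | true rewrite ==⇒≡ x=y = a , here refl , m∣m*n _
... | false with ∈ᵇ-zip-∣ h ys as x∈ (suc-injective len)
...   | a′ , a′∈ , ∣rest = a′ , there a′∈ , ∣-trans ∣rest (n∣m*n (h a y))

∏-zip-repeat : ∀ {P : A → Set} (h : A → ℕ → ℕ) → (∀ {a a′ v} → P a → P a′ → a ≢ a′ → h a v * h a′ v ≡ 0) →
               ∀ s {as} → All P as → Unique as → length s ≡ length as → distinct s ≡ false →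
               ∏ (uncurry h) (zip as s) ≡ 0
∏-zip-repeat h clash (x ∷ xs) {a ∷ as} (pa ∷ pas) (a∉ ∷ u) len d with x ∈ᵇ xs in x∈
... | false = trans (cong (h a x *_) (∏-zip-repeat h clash xs pas u (suc-injective len) d)) (*-zeroʳ (h a x))
... | true with ∈ᵇ-zip-∣ h xs as x∈ (suc-injective len)
...   | a′ , a′∈ , ∣rest = 0∣⇒≡0 (subst (_∣ h a x * ∏ (uncurry h) (zip as xs))
                                  (clash pa (All.lookup pas a′∈) (All.lookup a∉ a′∈))
                                  (*-monoʳ-∣ (h a x) ∣rest))

record IsPartialPermutationMatrix (L M : ℕ) (h : ℕ → ℕ → ℕ) : Set where
  field
    entry≤1          : ∀ a v → h a v ≤ 1
    row-exclusive    : ∀ {a v v′} → v < M → v′ < M → v ≢ v′ → h a v * h a v′ ≡ 0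
    column-exclusive : ∀ {a a′ v} → a < L → a′ < L → a ≢ a′ → h a v * h a′ v ≡ 0

  row-sum≤1 : ∀ a → ∑[ v ∈ upTo M ] h a v ≤ 1
  row-sum≤1 a = ∑-exclusive≤1 (h a) (entry≤1 a) row-exclusive (all-upTo M) (upTo⁺ M)

entrySum : ℕ → ℕ → (ℕ → ℕ → ℕ) → ℕ
entrySum L M h = ∑[ a ∈ upTo L ] ∑[ v ∈ upTo M ] h a v

transpose : ∀ {L M h} → IsPartialPermutationMatrix L M h → IsPartialPermutationMatrix M L (λ v a → h a v)
transpose ppm = record
  { entry≤1          = λ v a → entry≤1 a v
  ; row-exclusive    = column-exclusive
  ; column-exclusive = row-exclusive
  }
  where open IsPartialPermutationMatrix ppm

entrySum-transpose : ∀ L M h → entrySum L M h ≡ entrySum M L (λ v a → h a v)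
entrySum-transpose L M h = ∑-comm h (upTo L) (upTo M)

entrySum≤rows : ∀ {L M h} → IsPartialPermutationMatrix L M h → entrySum L M h ≤ L
entrySum≤rows {L} {M} {h} ppm =
  subst (entrySum L M h ≤_) (length-upTo L) (∑-≤-length (IsPartialPermutationMatrix.row-sum≤1 ppm) (upTo L))

entrySum≤min : ∀ {L M h} → IsPartialPermutationMatrix L M h → entrySum L M h ≤ L ⊓ M
entrySum≤min {L} {M} {h} ppm =
  ⊓-glb (entrySum≤rows ppm) (subst (_≤ M) (sym (entrySum-transpose L M h)) (entrySum≤rows (transpose ppm)))

IsPartialMatching-swap : ∀ {L M ps} → IsPartialMatching L M ps → IsPartialMatching M L (map swap ps)
IsPartialMatching-swap {ps = ps} (u₁ , u₂ , <L , <M) =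
    subst Unique (map-∘ ps) u₂ , subst Unique (map-∘ ps) u₁
  , subst (All _) (map-∘ ps) <M , subst (All _) (map-∘ ps) <L

map-proj-zip : ∀ (xs : List A) (ys : List B) → length xs ≡ length ys →
               map proj₁ (zip xs ys) ≡ xs × map proj₂ (zip xs ys) ≡ ys
map-proj-zip []       []       _   = refl , refl
map-proj-zip (x ∷ xs) (y ∷ ys) len with map-proj-zip xs ys (suc-injective len)
... | e₁ , e₂ = cong (x ∷_) e₁ , cong (y ∷_) e₂

zip-IsPartialMatching : ∀ {L M} s → length s ≡ L → Unique s → All (_< M) s → IsPartialMatching L M (zip (upTo L) s)
zip-IsPartialMatching {L} s len u s<M =
    subst Unique (sym firsts) (upTo⁺ L) , subst Unique (sym seconds) u
  , subst (All _) (sym firsts) (all-upTo L) , subst (All _) (sym seconds) s<M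
  where
  firsts  = proj₁ (map-proj-zip (upTo L) s (trans (length-upTo L) (sym len)))
  seconds = proj₂ (map-proj-zip (upTo L) s (trans (length-upTo L) (sym len)))

module _ {X : Set} (xs : List X) {L M : ℕ} (h : X → ℕ → ℕ → ℕ)
         (ppm : All (λ x → IsPartialPermutationMatrix L M (h x)) xs) (F : ℕ → ℕ)
         (fiber : ∀ ps → IsPartialMatching L M ps → ∑[ x ∈ xs ] ∏ (uncurry (h x)) ps ≡ F (length ps)) where

  -- A matrix has entry sum L exactly when each of its L rows contains a one; expanding the product of
  -- the row sums, the placements with a repeated column vanish and the others are partial matchings.
  count-full-rows : ∑[ x ∈ xs ] 𝟙 (entrySum L M (h x) == L) ≡ (M P′ L) * F L
  count-full-rows = begin
    ∑[ x ∈ xs ] 𝟙 (entrySum L M (h x) == L)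
      ≡⟨ ∑-congᴬ ppm (λ {x} ppmx → trans (cong (λ k → 𝟙 (entrySum L M (h x) == k)) (sym (length-upTo L)))
                                     (𝟙-∑≡length (IsPartialPermutationMatrix.row-sum≤1 ppmx) (upTo L))) ⟩
    ∑[ x ∈ xs ] ∏[ a ∈ upTo L ] ∑[ v ∈ upTo M ] h x a v
      ≡⟨ ∑-cong (λ x → trans (∏-∑-expand (h x) (upTo L) (upTo M))
                         (cong (λ k → ∑[ s ∈ Ss k ] ∏ (uncurry (h x)) (zip (upTo L) s)) (length-upTo L))) xs ⟩
    ∑[ x ∈ xs ] ∑[ s ∈ Ss L ] ∏ (uncurry (h x)) (zip (upTo L) s)
      ≡⟨ ∑-comm _ xs (Ss L) ⟩
    ∑[ s ∈ Ss L ] ∑[ x ∈ xs ] ∏ (uncurry (h x)) (zip (upTo L) s)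
      ≡⟨ ∑-congᴬ (sequences-shape L (all-upTo M)) placements ⟩
    ∑[ s ∈ Ss L ] (𝟙 (distinct s) * F L)
      ≡⟨ ∑-*ʳ _ (F L) (Ss L) ⟩
    ∑[ s ∈ Ss L ] 𝟙 (distinct s) * F L
      ≡⟨ cong (_* F L) (∑-distinct-sequences M L) ⟩
    (M P′ L) * F L ∎
    where
    Ss = sequences (upTo M)
    placements : ∀ {s} → length s ≡ L × All (_< M) s →
                 ∑[ x ∈ xs ] ∏ (uncurry (h x)) (zip (upTo L) s) ≡ 𝟙 (distinct s) * F L
    placements {s} (len , s<M) with distinct s in ds
    ... | true  = begin
      ∑[ x ∈ xs ] ∏ (uncurry (h x)) (zip (upTo L) s)
        ≡⟨ fiber _ (zip-IsPartialMatching s len (distinct⇒Unique s ds) s<M) ⟩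
      F (length (zip (upTo L) s))
        ≡⟨ cong F (trans (length-zipWith _,_ (upTo L) s) (trans (cong₂ _⊓_ (length-upTo L) len) (⊓-idem L))) ⟩
      F L
        ≡⟨ sym (+-identityʳ (F L)) ⟩
      1 * F L ∎
    ... | false = trans (∑-congᴬ ppm λ ppmx → ∏-zip-repeat _ (IsPartialPermutationMatrix.column-exclusive ppmx) s
                          (all-upTo L) (upTo⁺ L) (trans len (sym (length-upTo L))) ds) (∑-0 xs)

module _ {X : Set} (xs : List X) {L M : ℕ} (h : X → ℕ → ℕ → ℕ)
         (ppm : All (λ x → IsPartialPermutationMatrix L M (h x)) xs) (F : ℕ → ℕ)
         (fiber : ∀ ps → IsPartialMatching L M ps → ∑[ x ∈ xs ] ∏ (uncurry (h x)) ps ≡ F (length ps)) where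

  count-full-columns : ∑[ x ∈ xs ] 𝟙 (entrySum L M (h x) == M) ≡ (L P′ M) * F M
  count-full-columns = begin
    ∑[ x ∈ xs ] 𝟙 (entrySum L M (h x) == M)
      ≡⟨ ∑-cong (λ x → cong (λ t → 𝟙 (t == M)) (entrySum-transpose L M (h x))) xs ⟩
    ∑[ x ∈ xs ] 𝟙 (entrySum M L (λ v a → h x a v) == M)
      ≡⟨ count-full-rows xs (λ x v a → h x a v) (All.map transpose ppm) F fiberᵀ ⟩
    (L P′ M) * F M ∎
    where
    fiberᵀ : ∀ ps → IsPartialMatching M L ps → ∑[ x ∈ xs ] ∏[ p ∈ ps ] h x (proj₂ p) (proj₁ p) ≡ F (length ps)
    fiberᵀ ps matching = trans (∑-cong (λ x → sym (∏-map (uncurry (h x)) swap ps)) xs)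
      (trans (fiber (map swap ps) (IsPartialMatching-swap matching)) (cong F (length-map swap ps)))

  count-full-min : let ℓ = L ⊓ M in ∑[ x ∈ xs ] 𝟙 (entrySum L M (h x) == ℓ) ≡ F ℓ * ℓ ! * (L C ℓ) * (M C ℓ)
  count-full-min with L ≤? M
  ... | yes L≤M rewrite m≤n⇒m⊓n≡m L≤M = begin
    ∑[ x ∈ xs ] 𝟙 (entrySum L M (h x) == L)   ≡⟨ count-full-rows xs h ppm F fiber ⟩
    (M P′ L) * F L                              ≡⟨ cong (_* F L) (sym (k!*nCk≡nP′k L≤M)) ⟩
    L ! * (M C L) * F L                         ≡⟨ solve 3 (λ a c f → a :* c :* f := f :* a :* con 1 :* c)
                                                             refl (L !) (M C L) (F L) ⟩
    F L * L ! * 1 * (M C L)                     ≡⟨ cong (λ t → F L * L ! * t * (M C L)) (sym (nCn≡1 L)) ⟩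
    F L * L ! * (L C L) * (M C L)               ∎
  ... | no L≰M rewrite m≥n⇒m⊓n≡n (<⇒≤ (≰⇒> L≰M)) = begin
    ∑[ x ∈ xs ] 𝟙 (entrySum L M (h x) == M)   ≡⟨ count-full-columns ⟩
    (L P′ M) * F M                              ≡⟨ cong (_* F M) (sym (k!*nCk≡nP′k (<⇒≤ (≰⇒> L≰M)))) ⟩
    M ! * (L C M) * F M                         ≡⟨ solve 3 (λ a c f → a :* c :* f := f :* a :* c :* con 1)
                                                             refl (M !) (L C M) (F M) ⟩
    F M * M ! * (L C M) * 1                     ≡⟨ cong (F M * M ! * (L C M) *_) (sym (nCn≡1 M)) ⟩
    F M * M ! * (L C M) * (M C M)               ∎

complement-bounds : ∀ {n k} → n < k + k → k < n → (n ∸ k) + k ≡ n × n ∸ k < k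
complement-bounds {n} {k} n<2k k<n = n∸k+k≡n , +-cancelʳ-< k (n ∸ k) k (subst (_< k + k) (sym n∸k+k≡n) n<2k)
  where n∸k+k≡n = m∸n+n≡m (<⇒≤ k<n)

module InversionMatrix (n k₁ k₂ : ℕ) (n<2k₁ : n < k₁ + k₁) (k₁<n : k₁ < n) (n<2k₂ : n < k₂ + k₂) (k₂<n : k₂ < n) where

  m₁ m₂ : ℕ
  m₁ = n ∸ k₁
  m₂ = n ∸ k₂

  m₁+k₁≡n : m₁ + k₁ ≡ n
  m₁+k₁≡n = proj₁ (complement-bounds n<2k₁ k₁<n)

  m₂+k₂≡n : m₂ + k₂ ≡ n
  m₂+k₂≡n = proj₁ (complement-bounds n<2k₂ k₂<n)

  m₁<k₁ : m₁ < k₁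
  m₁<k₁ = proj₂ (complement-bounds n<2k₁ k₁<n)

  m₂<k₂ : m₂ < k₂
  m₂<k₂ = proj₂ (complement-bounds n<2k₂ k₂<n)

  -- The cell (a, v) records the (k₁,k₂)-inversion (a, a + k₁) with π(a + k₁) = v.
  cell : ℕ → ℕ → Assignment
  cell a v = (a + k₁ , v) ∷ (a , v + k₂) ∷ []

  w : List ℕ → ℕ → ℕ → ℕ
  w π a v = satisfies (cell a v) π

  inversion-indicator : ∀ {π} → IsArrangement n π → ∀ {a} → a < m₁ →
                        𝟙 (at π a == at π (a + k₁) + k₂) ≡ ∑[ v ∈ upTo m₂ ] w π a v
  inversion-indicator {π} (len , _ , π<n) {a} a<m₁ =
    sym (trans (∑-cong δ-form (upTo m₂)) (by-target (at π (a + k₁) <? m₂)))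
    where
    x = at π (a + k₁)
    δ-form : ∀ v → w π a v ≡ 𝟙 (v == x) * 𝟙 (at π a == v + k₂)
    δ-form v = cong₂ _*_ (cong 𝟙 (==-sym x v)) (*-identityʳ _)
    by-target : Dec (x < m₂) → ∑[ v ∈ upTo m₂ ] (𝟙 (v == x) * 𝟙 (at π a == v + k₂)) ≡ 𝟙 (at π a == x + k₂)
    by-target (yes x<m₂) = ∑-δ (λ v → 𝟙 (at π a == v + k₂)) x<m₂
    by-target (no  x≮m₂) = trans (∑-δ-out _ (≮⇒≥ x≮m₂)) (cong 𝟙 (sym (==-false λ πa≡ →
      <-irrefl πa≡ (<-≤-trans (All-at π<n (subst (a <_) (sym len) (<-≤-trans a<m₁ (m∸n≤m n k₁))))
                              (subst (_≤ x + k₂) m₂+k₂≡n (+-monoˡ-≤ k₂ (≮⇒≥ x≮m₂)))))))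

  invStep≡entrySum : ∀ {π} → IsArrangement n π → invStep k₁ k₂ π ≡ entrySum m₁ m₂ (w π)
  invStep≡entrySum {π} arr@(len , _) = begin
    invStep k₁ k₂ π
      ≡⟨ length-filterᵇ _ (upTo (length π ∸ k₁)) ⟩
    ∑[ a ∈ upTo (length π ∸ k₁) ] 𝟙 (at π a == at π (a + k₁) + k₂)
      ≡⟨ cong (λ l → ∑[ a ∈ upTo (l ∸ k₁) ] 𝟙 (at π a == at π (a + k₁) + k₂)) len ⟩
    ∑[ a ∈ upTo m₁ ] 𝟙 (at π a == at π (a + k₁) + k₂)
      ≡⟨ ∑-upTo-cong m₁ (inversion-indicator arr) ⟩
    entrySum m₁ m₂ (w π) ∎

  w*w≡0 : ∀ π {a v a′ v′} → (at π (a + k₁) ≡ v → at π (a′ + k₁) ≡ v′ → ⊥) → w π a v * w π a′ v′ ≡ 0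
  w*w≡0 π {a} {v} {a′} {v′} incompatible = begin
    w π a v * w π a′ v′            ≡⟨ solve 4 (λ p q r s → p :* (q :* con 1) :* (r :* (s :* con 1)) := p :* r :* (q :* s))
                                                refl x y x′ y′ ⟩
    x * x′ * (y * y′)              ≡⟨ cong (_* (y * y′)) (𝟙==*𝟙==≡0 incompatible) ⟩
    0                              ∎
    where
    x  = 𝟙 (at π (a + k₁) == v)
    y  = 𝟙 (at π a == v + k₂)
    x′ = 𝟙 (at π (a′ + k₁) == v′)
    y′ = 𝟙 (at π a′ == v′ + k₂)

  w-ppm : ∀ {π} → IsArrangement n π → IsPartialPermutationMatrix m₁ m₂ (w π)
  w-ppm {π} (len , u , _) = record
    { entry≤1          = λ a v → satisfies≤1 (cell a v) π
    ; row-exclusive    = λ _ _ v≢v′ → w*w≡0 π λ e e′ → v≢v′ (trans (sym e) e′)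
    ; column-exclusive = λ a<m₁ a′<m₁ a≢a′ → w*w≡0 π λ e e′ →
        a≢a′ (+-cancelʳ-≡ k₁ _ _ (at-injective u (shifted< a<m₁) (shifted< a′<m₁) (trans e (sym e′))))
    }
    where
    shifted< : ∀ {a} → a < m₁ → a + k₁ < length π
    shifted< a<m₁ = subst (_ <_) (trans m₁+k₁≡n (sym len)) (+-monoˡ-< k₁ a<m₁)

  positions-cells : ∀ ps → positions (concatMap (uncurry cell) ps) ≡ doubled (_+ k₁) id (map proj₁ ps)
  positions-cells []       = refl
  positions-cells (p ∷ ps) = cong (λ t → proj₁ p + k₁ ∷ proj₁ p ∷ t) (positions-cells ps)

  values-cells : ∀ ps → values (concatMap (uncurry cell) ps) ≡ doubled id (_+ k₂) (map proj₂ ps)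
  values-cells []       = refl
  values-cells (p ∷ ps) = cong (λ t → proj₂ p ∷ proj₂ p + k₂ ∷ t) (values-cells ps)

  length-cells : ∀ ps → length (concatMap (uncurry cell) ps) ≡ length ps + length ps
  length-cells []       = refl
  length-cells (p ∷ ps) = cong suc (trans (cong suc (length-cells ps)) (sym (+-suc (length ps) (length ps))))

  cells-matching : ∀ {ps} → IsPartialMatching m₁ m₂ ps → IsPartialMatching n n (concatMap (uncurry cell) ps)
  cells-matching {ps} (u₁ , u₂ , <m₁ , <m₂) =
      subst Unique (sym (positions-cells ps))
        (Unique-doubled {P = _< k₁} (_+ k₁) id (+-cancelʳ-≡ k₁ _ _) id
          (λ {x} _ y<k₁ x+k₁≡y → <⇒≱ y<k₁ (subst (k₁ ≤_) x+k₁≡y (m≤n+m k₁ x)))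
          (All.map (λ a<m₁ → <-trans a<m₁ m₁<k₁) <m₁) u₁)
    , subst Unique (sym (values-cells ps))
        (Unique-doubled {P = _< k₂} id (_+ k₂) id (+-cancelʳ-≡ k₂ _ _)
          (λ {_} {y} x<k₂ _ x≡y+k₂ → <⇒≱ x<k₂ (subst (k₂ ≤_) (sym x≡y+k₂) (m≤n+m k₂ y)))
          (All.map (λ v<m₂ → <-trans v<m₂ m₂<k₂) <m₂) u₂)
    , subst (All (_< n)) (sym (positions-cells ps))
        (All-doubled _ _ (All.map (λ a<m₁ → subst (_ <_) m₁+k₁≡n (+-monoˡ-< k₁ a<m₁) , <-≤-trans a<m₁ (m∸n≤m n k₁))
                                  <m₁))
    , subst (All (_< n)) (sym (values-cells ps))
        (All-doubled _ _ (All.map (λ v<m₂ → <-≤-trans v<m₂ (m∸n≤m n k₂) , subst (_ <_) m₂+k₂≡n (+-monoˡ-< k₂ v<m₂))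
                                  <m₂))

  fiber : ∀ ps → IsPartialMatching m₁ m₂ ps → ∑[ π ∈ perms n ] ∏ (uncurry (w π)) ps ≡ (n ∸ (length ps + length ps)) !
  fiber ps matching = begin
    ∑[ π ∈ perms n ] ∏ (uncurry (w π)) ps
      ≡⟨ ∑-cong (λ π → satisfies-concatMap (uncurry cell) π ps) (perms n) ⟩
    ∑[ π ∈ perms n ] satisfies (concatMap (uncurry cell) ps) π
      ≡⟨ ∑-perms-satisfies n (cells-matching matching) ⟩
    (n ∸ length (concatMap (uncurry cell) ps)) !
      ≡⟨ cong (λ l → (n ∸ l) !) (length-cells ps) ⟩
    (n ∸ (length ps + length ps)) ! ∎

  ℓ : ℕ
  ℓ = m₁ ⊓ m₂

  w-ppms : All (λ π → IsPartialPermutationMatrix m₁ m₂ (w π)) (perms n)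
  w-ppms = All.map w-ppm (perms-arrangement n)

  Hcoeff≡count : ∀ j → Hcoeff n k₁ k₂ j ≡ ∑[ π ∈ perms n ] 𝟙 (entrySum m₁ m₂ (w π) == j)
  Hcoeff≡count j = trans (length-filterᵇ _ (perms n))
    (∑-congᴬ (perms-arrangement n) λ arr → cong (λ t → 𝟙 (t == j)) (invStep≡entrySum arr))

  Hcoeff-above : ∀ j → ℓ < j → Hcoeff n k₁ k₂ j ≡ 0
  Hcoeff-above j ℓ<j = trans (Hcoeff≡count j) (trans (∑-congᴬ w-ppms λ ppm →
    cong 𝟙 (==-false λ sum≡j → <-irrefl sum≡j (≤-<-trans (entrySum≤min ppm) ℓ<j))) (∑-0 (perms n)))

  Hcoeff-leading : Hcoeff n k₁ k₂ ℓ ≡ (n ∸ (ℓ + ℓ)) ! * ℓ ! * (m₁ C ℓ) * (m₂ C ℓ)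
  Hcoeff-leading =
    trans (Hcoeff≡count ℓ) (count-full-min (perms n) w w-ppms (λ k → (n ∸ (k + k)) !) fiber)

  leading≢0 : (n ∸ (ℓ + ℓ)) ! * ℓ ! * (m₁ C ℓ) * (m₂ C ℓ) ≢ 0
  leading≢0 =
    *-≢0 (*-≢0 (*-≢0 (factorial≢0 (n ∸ (ℓ + ℓ))) (factorial≢0 ℓ)) (nCk≢0 (m⊓n≤m m₁ m₂))) (nCk≢0 (m⊓n≤n m₁ m₂))
    where
    factorial≢0 : ∀ k → k ! ≢ 0
    factorial≢0 k = ≢-nonZero⁻¹ (k !) {{k !≢0}}

proposition4p6 : (n k₁ k₂ : ℕ) → n < k₁ + k₁ → k₁ < n → n < k₂ + k₂ → k₂ < n →
    let ℓ = (n ∸ k₁) ⊓ (n ∸ k₂) in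
    Hcoeff n k₁ k₂ ℓ ≢ 0
    × (∀ j → ℓ < j → Hcoeff n k₁ k₂ j ≡ 0)
    × Hcoeff n k₁ k₂ ℓ ≡ (n ∸ (ℓ + ℓ)) ! * ℓ ! * ((n ∸ k₁) C ℓ) * ((n ∸ k₂) C ℓ)
proposition4p6 n k₁ k₂ n<2k₁ k₁<n n<2k₂ k₂<n =
  (λ H≡0 → leading≢0 (trans (sym Hcoeff-leading) H≡0)) , Hcoeff-above , Hcoeff-leading
  where open InversionMatrix n k₁ k₂ n<2k₁ k₁<n n<2k₂ k₂<n
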